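{- Let $G$ be a graph and let $f$ be an arithmetic integer additive set-indexer of $G$. Then $f$ is not a weak integer additive set-indexer of $G$.
   Context: All graphs are simple, finite and have no isolated vertices. $\mathbb{N}_0$ is the set of non-negative integers and $2^{\mathbb{N}_0}$ its power set; all sets considered are finite. For $A,B\subseteq\mathbb{N}_0$, $A+B=\{a+b: a\in A, b\in B\}$. An integer additive set-indexer (IASI) of $G$ is an injective function $f:V(G)\to 2^{\mathbb{N}_0}$ such that the induced function $f^+:E(G)\to 2^{\mathbb{N}_0}$, $f^+(uv)=f(u)+f(v)$, is also injective. An AP-set is a finite set of non-negative integers whose elements, listed in increasing order, form an arithmetic progression; as the paper stipulates, such sets arising as set-labels contain at least three elements. An IASI $f$ is vertex-arithmetic if $f(v)$ is an AP-set for every vertex $v$, edge-arithmetic if $f^+(e)$ is an AP-set for every edge $e$, and an arithmetic IASI if it is both. An IASI $f$ is a weak IASI if $|f^+(uv)|=\max(|f(u)|,|f(v)|)$ for every edge $uv$ of $G$. -}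

module Defs where

open import Data.Nat using (ℕ; _+_; _*_; _<_; _≤_; _⊔_)
open import Data.Nat.Properties using (_≟_)
open import Data.Fin using (Fin)
open import Data.List using (List; length; deduplicate; cartesianProductWith)
open import Data.List.Membership.Propositional using (_∈_)
open import Data.Product using (Σ; _×_; ∃; ∃-syntax; _,_)
open import Data.Sum using (_⊎_)
open import Data.Empty using (⊥)
open import Relation.Nullary using (¬_)
open import Relation.Binary.PropositionalEquality using (_≡_)
open import Function.Bundles using (_⇔_)

-- A finite set of non-negative integers is represented by a list;
-- the set it denotes is its membership predicate.
FinSet : Set
FinSet = List ℕ

_≐_ : FinSet → FinSet → Set
A ≐ B = ∀ x → (x ∈ A) ⇔ (x ∈ B)

∣_∣ : FinSet → ℕ
∣ A ∣ = length (deduplicate _≟_ A)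

_⊕_ : FinSet → FinSet → FinSet
A ⊕ B = cartesianProductWith _+_ A B

IsAPSet : FinSet → Set
IsAPSet A = (3 ≤ ∣ A ∣) ×
  (∃[ a ] ∃[ d ] ((0 < d) ×
     (∀ x → (x ∈ A) ⇔ (∃[ i ] ((i < ∣ A ∣) × (x ≡ a + i * d))))))

record Graph : Set₁ where
  field
    n        : ℕ
    Adj      : Fin n → Fin n → Set
    sym      : ∀ {u v} → Adj u v → Adj v u
    irrefl   : ∀ {u} → ¬ Adj u u
    noIsol   : ∀ u → ∃[ v ] Adj u v

open Graph public

record IsIASI (G : Graph) (f : Fin (n G) → FinSet) : Set where
  field
    vertexInj : ∀ u v → f u ≐ f v → u ≡ v
    edgeInj   : ∀ u v x y → Adj G u v → Adj G x y →
                (f u ⊕ f v) ≐ (f x ⊕ f y) →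
                ((u ≡ x) × (v ≡ y)) ⊎ ((u ≡ y) × (v ≡ x))

IsVertexArithmetic : (G : Graph) → (Fin (n G) → FinSet) → Set
IsVertexArithmetic G f = ∀ v → IsAPSet (f v)

IsEdgeArithmetic : (G : Graph) → (Fin (n G) → FinSet) → Set
IsEdgeArithmetic G f = ∀ u v → Adj G u v → IsAPSet (f u ⊕ f v)

IsArithmeticIASI : (G : Graph) → (Fin (n G) → FinSet) → Set
IsArithmeticIASI G f = IsIASI G f × IsVertexArithmetic G f × IsEdgeArithmetic G f

IsWeakIASI : (G : Graph) → (Fin (n G) → FinSet) → Set
IsWeakIASI G f = IsIASI G f ×
  (∀ u v → Adj G u v → ∣ f u ⊕ f v ∣ ≡ ∣ f u ∣ ⊔ ∣ f v ∣)

-- A weak IASI needs |f(u) + f(v)| = max(|f(u)|, |f(v)|) on every edge uv.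
-- But a sumset A + B is strictly larger than A as soon as B has two
-- elements b₁ < b₂: the translate A + b₁ lies in A + B, and max A + b₂ lies
-- in A + B beyond it.  AP-sets have at least two elements, so on any edge
-- |f(u) + f(v)| exceeds both |f(u)| and |f(v)|.
module Submission where

open import Defs
open import Data.Nat using (ℕ; suc; _+_; _*_; _<_; _≤_; z≤n; s≤s)
open import Data.Nat.Properties
  using (_≟_; >⇒≢; ≤-trans; +-comm; +-cancelʳ-≡; +-mono-≤-<; +-monoʳ-<; <-≤-trans; m≤m+n; ⊔-lub)
open import Data.Fin using (Fin; fromℕ<)
open import Data.List using (List; []; _∷_; length; map; filter; deduplicate)
open import Data.List.Properties using (length-map; filter-notAll)
open import Data.List.Extrema.Nat using (max; ⊥≤max; xs≤max; argmax-sel)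
open import Data.List.Membership.Propositional using (_∈_)
open import Data.List.Membership.Propositional.Properties
  using (∈-map⁻; ∈-filter⁺; ∈-cartesianProductWith⁺; ∈-cartesianProductWith⁻;
         ∈-deduplicate⁺; ∈-deduplicate⁻)
open import Data.List.Relation.Binary.Subset.Propositional using (_⊆_)
open import Data.List.Relation.Unary.Any as Any using (Any; here; there)
open import Data.List.Relation.Unary.All as All using (All; _∷_)
open import Data.List.Relation.Unary.AllPairs using ([]; _∷_)
open import Data.List.Relation.Unary.Unique.Propositional using (Unique)
open import Data.List.Relation.Unary.Unique.Propositional.Properties using (map⁺)
open import Data.List.Relation.Unary.Unique.DecPropositional.Properties using (deduplicate-!)
open import Data.Product using (_×_; ∃-syntax; ∃₂; _,_; proj₁; proj₂)
open import Data.Sum using (inj₁; inj₂)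
open import Function using (id; case_of_)
open import Function.Bundles using (Equivalence)
open import Relation.Binary.Definitions using (DecidableEquality)
open import Relation.Unary using (Decidable)
open import Relation.Binary.PropositionalEquality using (_≡_; refl; cong; subst)
open import Relation.Nullary using (¬_; ¬?)

Unique-⊆⇒length≤ : {A : Set} (_≟ᴬ_ : DecidableEquality A) {xs ys : List A} →
  Unique xs → xs ⊆ ys → length xs ≤ length ys
Unique-⊆⇒length≤ _≟ᴬ_ {xs = []}     []           _       = z≤n
Unique-⊆⇒length≤ _≟ᴬ_ {xs = x ∷ xs} {ys} (x∉xs ∷ !xs) x∷xs⊆ys =
  ≤-trans (s≤s (Unique-⊆⇒length≤ _≟ᴬ_ !xs xs⊆ys∖x)) (filter-notAll ≢x? ys x∈ys)
  where
  ≢x? : Decidable (λ y → ¬ x ≡ y)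
  ≢x? = λ y → ¬? (x ≟ᴬ y)
  xs⊆ys∖x : xs ⊆ filter ≢x? ys
  xs⊆ys∖x z∈xs = ∈-filter⁺ ≢x? (x∷xs⊆ys (there z∈xs)) (All.lookup x∉xs z∈xs)
  x∈ys : Any (λ y → ¬ ¬ x ≡ y) ys
  x∈ys = Any.map (λ x≡y x≢y → x≢y x≡y) (x∷xs⊆ys (here refl))

Unique-⊆⇒length≤∣∣ : {xs C : FinSet} → Unique xs → xs ⊆ C → length xs ≤ ∣ C ∣
Unique-⊆⇒length≤∣∣ !xs xs⊆C = Unique-⊆⇒length≤ _≟_ !xs (λ z∈xs → ∈-deduplicate⁺ _≟_ (xs⊆C z∈xs))

∣∣-mono-⊆ : {A B : FinSet} → A ⊆ B → ∣ A ∣ ≤ ∣ B ∣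
∣∣-mono-⊆ {A} A⊆B =
  Unique-⊆⇒length≤∣∣ (deduplicate-! _≟_ A) (λ z∈ → A⊆B (∈-deduplicate⁻ _≟_ A z∈))

⊕-comm-⊆ : (A B : FinSet) → A ⊕ B ⊆ B ⊕ A
⊕-comm-⊆ A B z∈A⊕B with ∈-cartesianProductWith⁻ _+_ A B z∈A⊕B
... | a , b , a∈A , b∈B , refl =
  subst (_∈ B ⊕ A) (+-comm b a) (∈-cartesianProductWith⁺ _+_ b∈B a∈A)

∃-max : {x : ℕ} {A : FinSet} → x ∈ A → ∃[ m ] (m ∈ A × All (_≤ m) A)
∃-max {A = y ∷ ys} _ = max y ys , max∈ , ⊥≤max y ys ∷ xs≤max y ys
  where
  max∈ : max y ys ∈ y ∷ ys
  max∈ with argmax-sel id y ys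
  ... | inj₁ max≡y  = here max≡y
  ... | inj₂ max∈ys = there max∈ys

∣∣<∣⊕∣ : {x b₁ b₂ : ℕ} {A B : FinSet} → x ∈ A → b₁ ∈ B → b₂ ∈ B → b₁ < b₂ →
  ∣ A ∣ < ∣ A ⊕ B ∣
∣∣<∣⊕∣ {_} {b₁} {b₂} {A} {B} x∈A b₁∈B b₂∈B b₁<b₂ with ∃-max x∈A
... | m , m∈A , A≤m =
  subst (_≤ ∣ A ⊕ B ∣) (cong suc (length-map (_+ b₁) D)) (Unique-⊆⇒length≤∣∣ !L L⊆A⊕B)
  where
  D : FinSet
  D = deduplicate _≟_ A
  A+b₁ : FinSet
  A+b₁ = map (_+ b₁) D
  sum∈ : ∀ {a b} → a ∈ A → b ∈ B → a + b ∈ A ⊕ B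
  sum∈ = ∈-cartesianProductWith⁺ _+_
  A+b₁<m+b₂ : All (_< m + b₂) A+b₁
  A+b₁<m+b₂ = All.tabulate λ z∈ → case ∈-map⁻ (_+ b₁) z∈ of λ where
    (a , a∈D , refl) → +-mono-≤-< (All.lookup A≤m (∈-deduplicate⁻ _≟_ A a∈D)) b₁<b₂
  !L : Unique (m + b₂ ∷ A+b₁)
  !L = All.map >⇒≢ A+b₁<m+b₂
     ∷ map⁺ (+-cancelʳ-≡ b₁ _ _) (deduplicate-! _≟_ A)
  L⊆A⊕B : m + b₂ ∷ A+b₁ ⊆ A ⊕ B
  L⊆A⊕B (here refl) = sum∈ m∈A b₂∈B
  L⊆A⊕B (there z∈) with ∈-map⁻ (_+ b₁) z∈
  ... | a , a∈D , refl = sum∈ (∈-deduplicate⁻ _≟_ A a∈D) b₁∈B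

IsAPSet⇒∃< : {A : FinSet} → IsAPSet A → ∃₂ λ x y → x ∈ A × y ∈ A × x < y
IsAPSet⇒∃< {A} (3≤∣A∣ , a , d , 0<d , A≐AP) =
  a + 0 * d , a + 1 * d ,
  term∈ 0 (≤-trans (s≤s z≤n) 3≤∣A∣) , term∈ 1 (≤-trans (s≤s (s≤s z≤n)) 3≤∣A∣) ,
  +-monoʳ-< a (<-≤-trans 0<d (m≤m+n d 0))
  where
  term∈ : ∀ i → i < ∣ A ∣ → a + i * d ∈ A
  term∈ i i<∣A∣ = Equivalence.from (A≐AP (a + i * d)) (i , i<∣A∣ , refl)

IsAPSet⇒∣∣<∣⊕∣ : {A B : FinSet} → IsAPSet A → IsAPSet B → ∣ A ∣ < ∣ A ⊕ B ∣
IsAPSet⇒∣∣<∣⊕∣ apA apB with IsAPSet⇒∃< apA | IsAPSet⇒∃< apB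
... | x , _ , x∈A , _ | _ , _ , b₁∈B , b₂∈B , b₁<b₂ = ∣∣<∣⊕∣ x∈A b₁∈B b₂∈B b₁<b₂

proposition2p1 : (G : Graph) → 0 < n G → (f : Fin (n G) → FinSet) →
    IsArithmeticIASI G f → ¬ IsWeakIASI G f
proposition2p1 G 0<n f (_ , isAP , _) (_ , weak) =
  >⇒≢ (⊔-lub ∣fu∣<∣fu⊕fv∣ ∣fv∣<∣fu⊕fv∣) (weak u v uv)
  where
  u : Fin (n G)
  u = fromℕ< 0<n
  v : Fin (n G)
  v = proj₁ (noIsol G u)
  uv : Adj G u v
  uv = proj₂ (noIsol G u)
  ∣fu∣<∣fu⊕fv∣ : ∣ f u ∣ < ∣ f u ⊕ f v ∣
  ∣fu∣<∣fu⊕fv∣ = IsAPSet⇒∣∣<∣⊕∣ (isAP u) (isAP v)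
  ∣fv∣<∣fu⊕fv∣ : ∣ f v ∣ < ∣ f u ⊕ f v ∣
  ∣fv∣<∣fu⊕fv∣ = ≤-trans (IsAPSet⇒∣∣<∣⊕∣ (isAP v) (isAP u)) (∣∣-mono-⊆ (⊕-comm-⊆ (f v) (f u)))
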